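{- Let $G$ be a $K_4$-minor-free graph, $xx'$ an edge of $G$, and $y,z$ distinct vertices of $G$ not in $\{x,x'\}$. Then at least one of the sets $\{x,y,z\}$ and $\{x',y,z\}$ is feasible.
   Context: The chain of diamonds $D_n$ ($n\in\mathbb{N}$) has vertex set $\{u_i,v_i,w_i:i\in[n]\}\cup\{u_0\}$ and edges $\{u_{i-1}v_i,u_{i-1}w_i,v_iw_i,v_iu_i,w_iu_i:i\in[n]\}$; $U(D_n)=\{u_0,\dots,u_n\}$. A vertex set $X$ of $G$ is connected by a chain of diamonds if there are $n\in\mathbb{N}$ and a homomorphism $\varphi:D_n\to G$ with $X\subseteq\varphi(U(D_n))$. A set $X$ of three distinct vertices of $G$ is feasible if $X$ is not connected by a chain of diamonds and there is a proper $3$-coloring $\phi$ of $G$ with $|\phi(X)|\le2$. -}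

module Defs where

open import Data.Nat using (ℕ; suc)
open import Data.Fin using (Fin; inject₁) renaming (suc to fsuc)
open import Data.Maybe using (Maybe; just)
open import Data.Product using (Σ; ∃; _×_; _,_)
open import Data.Sum using (_⊎_)
open import Relation.Nullary using (¬_; Dec)
open import Relation.Binary.PropositionalEquality using (_≡_; _≢_)

record Graph : Set₁ where
  field
    n      : ℕ
    Adj    : Fin n → Fin n → Set
    sym    : ∀ {u v} → Adj u v → Adj v u
    irrefl : ∀ {u} → ¬ Adj u u
    adj?   : ∀ u v → Dec (Adj u v)

module _ (G : Graph) where
  open Graph G

  V : Set
  V = Fin n

  data WalkIn (P : V → Set) : V → V → Set where
    nil  : ∀ {u} → P u → WalkIn P u u
    cons : ∀ {u v w} → P u → Adj u v → WalkIn P v w → WalkIn P u w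

  -- A K4 minor model: branch sets B₀..B₃ given by β u = just i ⟺ u ∈ Bᵢ
  -- (so the branch sets are automatically pairwise disjoint); each branch set
  -- is nonempty and induces a connected subgraph, and any two distinct branch
  -- sets are joined by an edge.
  record K4Minor : Set where
    field
      β         : V → Maybe (Fin 4)
      nonempty  : ∀ i → ∃ λ u → β u ≡ just i
      connected : ∀ i u v → β u ≡ just i → β v ≡ just i →
                  WalkIn (λ w → β w ≡ just i) u v
      joined    : ∀ i j → i ≢ j →
                  ∃ λ u → ∃ λ v → β u ≡ just i × β v ≡ just j × Adj u v

  K4MinorFree : Set
  K4MinorFree = ¬ K4Minor

  -- A homomorphism φ : D_m → G, written out: φ(u_i) = uu i (i ∈ {0..m}),
  -- φ(v_i) = vv i, φ(w_i) = ww i (i ∈ [m], indexed here by Fin m, so that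
  -- index i : Fin m stands for i+1), and every edge of D_m maps to an edge of G.
  record DiamondChainHom (m : ℕ) : Set where
    field
      uu : Fin (suc m) → V
      vv : Fin m → V
      ww : Fin m → V
      e-uv : ∀ i → Adj (uu (inject₁ i)) (vv i)
      e-uw : ∀ i → Adj (uu (inject₁ i)) (ww i)
      e-vw : ∀ i → Adj (vv i) (ww i)
      e-vu : ∀ i → Adj (vv i) (uu (fsuc i))
      e-wu : ∀ i → Adj (ww i) (uu (fsuc i))

  InU : ∀ {m} → DiamondChainHom m → V → Set
  InU φ a = ∃ λ i → DiamondChainHom.uu φ i ≡ a

  ConnByDiamonds : V → V → V → Set
  ConnByDiamonds a b c =
    Σ ℕ λ m → Σ (DiamondChainHom m) λ φ → InU φ a × InU φ b × InU φ c

  Proper3Coloring : (V → Fin 3) → Set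
  Proper3Coloring col = ∀ {u v} → Adj u v → col u ≢ col v

  AtMostTwoColors : (V → Fin 3) → V → V → V → Set
  AtMostTwoColors col a b c = col a ≡ col b ⊎ col a ≡ col c ⊎ col b ≡ col c

  Feasible : V → V → V → Set
  Feasible a b c =
    (a ≢ b × a ≢ c × b ≢ c) ×
    ¬ ConnByDiamonds a b c ×
    ∃ λ col → Proper3Coloring col × AtMostTwoColors col a b c

-- K₄-minor-free graphs are 2-degenerate. This is proved in a rooted form: if R₁
-- and R₂ are disjoint, adjacent, connected root sets outside S, some vertex of a
-- nonempty S has at most two neighbours in the graph where R₁ and R₂ are
-- contracted to single nodes. The induction on S turns removed vertices into
-- roots; the key case is a vertex t touching both roots, where a component K of
-- S − t touching R₁, R₂ and t would make R₁, R₂, {t}, K the branch sets of a K₄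
-- minor. Greedy colouring along the degeneracy order gives a proper 3-colouring
-- c. In a diamond the two middle vertices use two colours, forcing both tips to
-- have the third, so c is constant on φ(U(Dₘ)). Now if c(y) = c(z), one of the
-- adjacent x, x' differs from it; if c(y) ≠ c(z), x and x' cannot both take the
-- third colour, so one of them repeats c(y) or c(z).
module Submission where

open import Data.Fin using (Fin; zero; suc; inject₁)
open import Data.Fin.Induction using (<-weakInduction)
open import Data.Fin.Properties using (all?; any?; _≟_; punchInᵢ≢i)
open import Data.Fin.Subset
  using (Subset; _∈_; _∉_; _⊆_; _⊂_; _⊃_; _─_; _-_; _∪_; ⁅_⁆; ⊤; Nonempty; Empty)
  renaming (⊥ to ∅)
open import Data.Fin.Subset.Induction using (⊂-wellFounded; ⊃-wellFounded)
open import Data.Fin.Subset.Properties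
  using (_∈?_; nonempty?; x∈⁅x⁆; x∈⁅y⁆⇒x≡y; ∉⊥; ∈⊤; p⊆p∪q; q⊆p∪q; x∈p∪q⁻; p─q⊆p;
         x∈p∧x≢y⇒x∈p-y; x∈p⇒p-x⊂p; ⊆-⊂-trans)
open import Data.Empty using (⊥-elim)
open import Data.Maybe using (Maybe; just; nothing)
open import Data.Product using (∃; ∃₂; _×_; _,_; proj₁; proj₂)
open import Data.Sum using (_⊎_; inj₁; inj₂; [_,_]′; map₂)
open import Data.Vec using (Vec; []; _∷_; lookup; here; there)
open import Data.Vec.Relation.Unary.All using (All; []; _∷_)
open import Data.Vec.Relation.Unary.All.Properties using (lookup⁺)
open import Data.Vec.Relation.Unary.AllPairs using (AllPairs; []; _∷_)
open import Function using (_∘_; id)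
open import Induction.WellFounded using (Acc; acc)
open import Relation.Binary.PropositionalEquality
  using (_≡_; _≢_; refl; sym; trans; cong; subst; ≢-sym)
open import Relation.Nullary using (¬_; Dec; yes; no; ¬?)
open import Relation.Nullary.Decidable using (toWitness; decidable-stable; _×-dec_; _⊎-dec_; _→-dec_)

open import Defs

_≢?_ : ∀ {k} (a b : Fin k) → Dec (a ≢ b)
a ≢? b = ¬? (a ≟ b)

third-colour : ∀ (a b : Fin 3) → ∃ λ c → c ≢ a × c ≢ b
third-colour = toWitness {a? = all? λ a → all? λ b → any? λ c → c ≢? a ×-dec c ≢? b} _

third-colour-unique : ∀ (a b c d : Fin 3) →
  a ≢ b → c ≢ a → c ≢ b → d ≢ a → d ≢ b → c ≡ d
third-colour-unique = toWitness {a? = all? λ a → all? λ b → all? λ c → all? λ d →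
  a ≢? b →-dec c ≢? a →-dec c ≢? b →-dec d ≢? a →-dec d ≢? b →-dec c ≟ d} _

distinct-pairs-meet : ∀ (a b c d : Fin 3) → a ≢ b → c ≢ d →
  (c ≡ a ⊎ c ≡ b) ⊎ (d ≡ a ⊎ d ≡ b)
distinct-pairs-meet = toWitness {a? = all? λ a → all? λ b → all? λ c → all? λ d →
  a ≢? b →-dec c ≢? d →-dec ((c ≟ a ⊎-dec c ≟ b) ⊎-dec (d ≟ a ⊎-dec d ≟ b))} _

AtMostTwo : {A : Set} → (A → Set) → Set
AtMostTwo {A} P = ∃₂ λ (i j : A) → ∀ x → P x → x ≡ i ⊎ x ≡ j

atMostTwo-image : {A B : Set} {P : A → Set} {Q : B → Set} (f : B → A) →
  (∀ x → P x → ∃ λ y → Q y × f y ≡ x) → AtMostTwo Q → AtMostTwo P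
atMostTwo-image f P⊆fQ (i , j , Q⊆ij) = f i , f j , P⊆fij
  where
  P⊆fij : ∀ x → _ → x ≡ f i ⊎ x ≡ f j
  P⊆fij x Px with P⊆fQ x Px
  ... | y , Qy , refl with Q⊆ij y Qy
  ...   | inj₁ refl = inj₁ refl
  ...   | inj₂ refl = inj₂ refl

allPairs-lookup : {A : Set} {R : A → A → Set} → (∀ {a b} → R a b → R b a) →
  ∀ {k} {xs : Vec A k} → AllPairs R xs → ∀ {i j} → i ≢ j → R (lookup xs i) (lookup xs j)
allPairs-lookup R-sym (_ ∷ _) {zero} {zero} i≢j = ⊥-elim (i≢j refl)
allPairs-lookup R-sym (Rx ∷ _) {zero} {suc j} _ = lookup⁺ Rx j
allPairs-lookup R-sym (Rx ∷ _) {suc i} {zero} _ = R-sym (lookup⁺ Rx i)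
allPairs-lookup R-sym (_ ∷ Rxs) {suc i} {suc j} i≢j = allPairs-lookup R-sym Rxs (i≢j ∘ cong suc)

x∈p─q⇒x∉q : ∀ {k} {x : Fin k} {p q : Subset k} → x ∈ p ─ q → x ∉ q
x∈p─q⇒x∉q {p = _ ∷ _} () here
x∈p─q⇒x∉q {p = _ ∷ _} (there x∈p─q) (there x∈q) = x∈p─q⇒x∉q x∈p─q x∈q

x∈p-y⇒x≢y : ∀ {k} {x y : Fin k} {p : Subset k} → x ∈ p - y → x ≢ y
x∈p-y⇒x≢y x∈p-y refl = x∈p─q⇒x∉q x∈p-y (x∈⁅x⁆ _)

x∈p⇒x≡y⊎x∈p-y : ∀ {k} {x : Fin k} {p : Subset k} y → x ∈ p → x ≡ y ⊎ x ∈ p - y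
x∈p⇒x≡y⊎x∈p-y {x = x} y x∈p with x ≟ y
... | yes x≡y = inj₁ x≡y
... | no x≢y = inj₂ (x∈p∧x≢y⇒x∈p-y x∈p x≢y)

module _ (G : Graph) where
  open Graph G renaming (sym to adj-sym)

  private variable
    S S′ R R₁ R₂ A B C : Subset n
    t u v w : V G

  adj⇒≢ : Adj u v → u ≢ v
  adj⇒≢ uv refl = irrefl uv

  module Walk where
    private variable
      P P′ : V G → Set

    head : WalkIn G P u v → P u
    head (nil Pu) = Pu
    head (cons Pu _ _) = Pu

    map : (∀ {x} → P x → P′ x) → WalkIn G P u v → WalkIn G P′ u v
    map f (nil Pu) = nil (f Pu)
    map f (cons Pu uv walk) = cons (f Pu) uv (map f walk)

    _++_ : WalkIn G P u v → WalkIn G P v w → WalkIn G P u w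
    nil _ ++ walk′ = walk′
    cons Pu uv walk ++ walk′ = cons Pu uv (walk ++ walk′)

    reverse : WalkIn G P u v → WalkIn G P v u
    reverse (nil Pu) = nil Pu
    reverse (cons Pu uv walk) = reverse walk ++ cons (head walk) (adj-sym uv) (nil Pu)

  Connected : Subset n → Set
  Connected S = ∀ {a b} → a ∈ S → b ∈ S → WalkIn G (_∈ S) a b

  Touches : Subset n → V G → Set
  Touches R v = ∃ λ w → w ∈ R × Adj v w

  Joined : Subset n → Subset n → Set
  Joined A B = ∃ λ a → a ∈ A × Touches B a

  Disjoint : Subset n → Subset n → Set
  Disjoint A B = ∀ {v} → v ∈ A → v ∉ B

  touches? : ∀ R v → Dec (Touches R v)
  touches? R v = any? λ w → w ∈? R ×-dec adj? v w

  joined? : ∀ A B → Dec (Joined A B)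
  joined? A B = any? λ a → a ∈? A ×-dec touches? B a

  touches-⁅⁆ : Adj v t → Touches ⁅ t ⁆ v
  touches-⁅⁆ {t = t} vt = t , x∈⁅x⁆ t , vt

  touches-⊆ : A ⊆ B → Touches A v → Touches B v
  touches-⊆ A⊆B (w , w∈A , vw) = w , A⊆B w∈A , vw

  joined-sym : Joined A B → Joined B A
  joined-sym (a , a∈A , b , b∈B , ab) = b , b∈B , a , a∈A , adj-sym ab

  disjoint-sym : Disjoint A B → Disjoint B A
  disjoint-sym A∩B v∈B v∈A = A∩B v∈A v∈B

  disjoint-⊆ : A ⊆ B → Disjoint B C → Disjoint A C
  disjoint-⊆ A⊆B B∩C = B∩C ∘ A⊆B

  disjoint-⁅⁆ : t ∉ A → Disjoint A ⁅ t ⁆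
  disjoint-⁅⁆ {t = t} t∉A v∈A v∈t = t∉A (subst (_∈ _) (x∈⁅y⁆⇒x≡y t v∈t) v∈A)

  connected-⁅⁆ : Connected ⁅ t ⁆
  connected-⁅⁆ {t = t} a∈t b∈t
    with refl ← x∈⁅y⁆⇒x≡y t a∈t | refl ← x∈⁅y⁆⇒x≡y t b∈t = nil a∈t

  connected-∪ : Connected A → Connected B → Joined A B → Connected (A ∪ B)
  connected-∪ {A} {B} A-conn B-conn (a , a∈A , b , b∈B , ab) = walk
    where
    A→B : ∀ {x y} → x ∈ A → y ∈ B → WalkIn G (_∈ A ∪ B) x y
    A→B x∈A y∈B = Walk.map (p⊆p∪q B) (A-conn x∈A a∈A) Walk.++
      cons (p⊆p∪q B a∈A) ab (Walk.map (q⊆p∪q A B) (B-conn b∈B y∈B))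

    walk : Connected (A ∪ B)
    walk {x} {y} x∈ y∈ with x∈p∪q⁻ A B x∈ | x∈p∪q⁻ A B y∈
    ... | inj₁ x∈A | inj₁ y∈A = Walk.map (p⊆p∪q B) (A-conn x∈A y∈A)
    ... | inj₁ x∈A | inj₂ y∈B = A→B x∈A y∈B
    ... | inj₂ x∈B | inj₁ y∈A = Walk.reverse (A→B y∈A x∈B)
    ... | inj₂ x∈B | inj₂ y∈B = Walk.map (q⊆p∪q A B) (B-conn x∈B y∈B)

  record Component (S : Subset n) (u : V G) : Set where
    field
      K         : Subset n
      u∈K       : u ∈ K
      K⊆S       : K ⊆ S
      connected : Connected K
      closed    : v ∈ K → w ∈ S → Adj v w → w ∈ K

  component : ∀ {S u} → u ∈ S → Component S u
  component {S} {u} u∈S = grow ⁅ u ⁆ (⊃-wellFounded _) (x∈⁅x⁆ u) u⊆S connected-⁅⁆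
    where
    u⊆S : ⁅ u ⁆ ⊆ S
    u⊆S v∈u = subst (_∈ S) (sym (x∈⁅y⁆⇒x≡y u v∈u)) u∈S

    grow : ∀ K → Acc _⊃_ K → u ∈ K → K ⊆ S → Connected K → Component S u
    grow K (acc larger) u∈K K⊆S K-conn
      with any? (λ w → w ∈? S ×-dec ¬? (w ∈? K) ×-dec touches? K w)
    ... | yes (w , w∈S , w∉K , v , v∈K , wv) =
      grow (K ∪ ⁅ w ⁆) (larger K⊂K∪w) (p⊆p∪q _ u∈K) K∪w⊆S
        (connected-∪ K-conn connected-⁅⁆ (v , v∈K , touches-⁅⁆ (adj-sym wv)))
      where
      K⊂K∪w : K ⊂ K ∪ ⁅ w ⁆
      K⊂K∪w = p⊆p∪q _ , w , q⊆p∪q K _ (x∈⁅x⁆ w) , w∉K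
      K∪w⊆S : K ∪ ⁅ w ⁆ ⊆ S
      K∪w⊆S x∈ with x∈p∪q⁻ K _ x∈
      ... | inj₁ x∈K = K⊆S x∈K
      ... | inj₂ x∈w = subst (_∈ S) (sym (x∈⁅y⁆⇒x≡y w x∈w)) w∈S
    ... | no no-exit = record
      { K = K ; u∈K = u∈K ; K⊆S = K⊆S ; connected = K-conn
      ; closed = λ {v} {w} v∈K w∈S vw → decidable-stable (w ∈? K)
                   λ w∉K → no-exit (w , w∈S , w∉K , v , v∈K , adj-sym vw) }

  record K4Model : Set where
    field
      branch    : Vec (Subset n) 4
      connected : All Connected branch
      disjoint  : AllPairs Disjoint branch
      joined    : AllPairs Joined branch

  k4Minor : K4Model → K4Minor G
  k4Minor model = record
    { β         = label
    ; nonempty  = nonempty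
    ; connected = λ i _ _ u∈i v∈i →
        Walk.map label-complete (lookup⁺ connected i (label-sound u∈i) (label-sound v∈i))
    ; joined    = λ i j i≢j →
        let a , a∈i , b , b∈j , ab = allPairs-lookup joined-sym joined i≢j
        in a , b , label-complete a∈i , label-complete b∈j , ab
    }
    where
    open K4Model model
    Branch : Fin 4 → Subset n
    Branch = lookup branch

    label : V G → Maybe (Fin 4)
    label v with any? (λ i → v ∈? Branch i)
    ... | yes (i , _) = just i
    ... | no _ = nothing

    label-sound : ∀ {i} → label v ≡ just i → v ∈ Branch i
    label-sound {v} eq with any? (λ i → v ∈? Branch i)
    label-sound refl | yes (_ , v∈i) = v∈i

    label-complete : ∀ {i} → v ∈ Branch i → label v ≡ just i
    label-complete {v} {i} v∈i with any? (λ i → v ∈? Branch i)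
    ... | no none = ⊥-elim (none (i , v∈i))
    ... | yes (j , v∈j) with j ≟ i
    ...   | yes refl = refl
    ...   | no j≢i = ⊥-elim (allPairs-lookup disjoint-sym disjoint j≢i v∈j v∈i)

    nonempty : ∀ i → ∃ λ v → label v ≡ just i
    nonempty i =
      let a , a∈i , _ = allPairs-lookup joined-sym joined (≢-sym (punchInᵢ≢i i zero))
      in a , label-complete a∈i

  -- The nodes of the graph obtained from G[S ∪ R₁ ∪ R₂] by contracting the
  -- root sets R₁ and R₂ to single nodes.
  data Node : Set where
    vertex      : V G → Node
    root₁ root₂ : Node

  NeighbourIn : Subset n → Subset n → Subset n → V G → Node → Set
  NeighbourIn S R₁ R₂ v (vertex w) = w ∈ S × Adj v w
  NeighbourIn S R₁ R₂ v root₁      = Touches R₁ v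
  NeighbourIn S R₁ R₂ v root₂      = Touches R₂ v

  HasLowVertex : Subset n → Subset n → Subset n → Set
  HasLowVertex S R₁ R₂ = ∃ λ v → v ∈ S × AtMostTwo (NeighbourIn S R₁ R₂ v)

  record Roots (S R₁ R₂ : Subset n) : Set where
    field
      S∩R₁=∅        : Disjoint S R₁
      S∩R₂=∅        : Disjoint S R₂
      R₁∩R₂=∅       : Disjoint R₁ R₂
      R₁-connected  : Connected R₁
      R₂-connected  : Connected R₂
      R₁-R₂-joined  : Joined R₁ R₂

  roots-⊆ : S′ ⊆ S → Roots S R₁ R₂ → Roots S′ R₁ R₂
  roots-⊆ S′⊆S roots = record
    { S∩R₁=∅ = disjoint-⊆ S′⊆S S∩R₁=∅ ; S∩R₂=∅ = disjoint-⊆ S′⊆S S∩R₂=∅ ; R₁∩R₂=∅ = R₁∩R₂=∅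
    ; R₁-connected = R₁-connected ; R₂-connected = R₂-connected ; R₁-R₂-joined = R₁-R₂-joined }
    where open Roots roots

  roots-⁅⁆ : t ∉ S → Disjoint S R → t ∉ R → Connected R → Touches R t → Roots S ⁅ t ⁆ R
  roots-⁅⁆ {t = t} t∉S S∩R t∉R R-conn t-R = record
    { S∩R₁=∅       = disjoint-⁅⁆ t∉S
    ; S∩R₂=∅       = S∩R
    ; R₁∩R₂=∅      = λ v∈t → subst (_∉ _) (sym (x∈⁅y⁆⇒x≡y t v∈t)) t∉R
    ; R₁-connected = connected-⁅⁆
    ; R₂-connected = R-conn
    ; R₁-R₂-joined = t , x∈⁅x⁆ t , t-R
    }

  LowBelow : Subset n → Set
  LowBelow S = ∀ {S′ Q₁ Q₂} → S′ ⊂ S → Roots S′ Q₁ Q₂ → Nonempty S′ → HasLowVertex S′ Q₁ Q₂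

  -- Every recursive call turns removed vertices of S into roots; relabelling
  -- maps the nodes of the smaller configuration back to the original ones.
  relabel : Node → Node → Node → Node
  relabel a b (vertex w) = vertex w
  relabel a b root₁      = a
  relabel a b root₂      = b

  root-neighbour : ∀ b → w ≡ t ⊎ w ∈ S → Adj v w →
    ∃ λ y → NeighbourIn S ⁅ t ⁆ R v y × relabel (vertex t) b y ≡ vertex w
  root-neighbour b (inj₁ refl) vw = root₁ , touches-⁅⁆ vw , refl
  root-neighbour b (inj₂ w∈S) vw = vertex _ , (w∈S , vw) , refl

  Isolated : Subset n → V G → Set
  Isolated S t = ∀ {w} → w ∈ S → ¬ Adj t w

  alone⇒isolated : Empty (S - t) → Isolated S t
  alone⇒isolated S-t=∅ w∈S tw = S-t=∅ (_ , x∈p∧x≢y⇒x∈p-y w∈S (≢-sym (adj⇒≢ tw)))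

  isolated-low : Isolated S t → AtMostTwo (NeighbourIn S R₁ R₂ t)
  isolated-low isolated = root₁ , root₂ , λ
    { (vertex w) (w∈S , tw) → ⊥-elim (isolated w∈S tw)
    ; root₁ _ → inj₁ refl
    ; root₂ _ → inj₂ refl }

  untouched-low : LowBelow S → (∀ {v} → v ∈ S → ¬ Touches R₁ v) → (∀ {v} → v ∈ S → ¬ Touches R₂ v) →
    Nonempty S → HasLowVertex S R₁ R₂
  untouched-low {S} {R₁} {R₂} rec ¬R₁ ¬R₂ (t , t∈S) with any? (λ s → s ∈? S ×-dec adj? t s)
  ... | no isolated = t , t∈S , isolated-low (λ w∈S tw → isolated (_ , w∈S , tw))
  ... | yes (s , s∈S , ts) with nonempty? (S - t - s)
  ...   | no S-t-s=∅ = t , t∈S , vertex s , vertex s , only-s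
    where
    only-s : ∀ x → NeighbourIn S R₁ R₂ t x → x ≡ vertex s ⊎ x ≡ vertex s
    only-s (vertex w) (w∈S , tw) with x∈p⇒x≡y⊎x∈p-y t w∈S
    ... | inj₁ refl = ⊥-elim (irrefl tw)
    ... | inj₂ w∈S-t with x∈p⇒x≡y⊎x∈p-y s w∈S-t
    ...   | inj₁ refl = inj₁ refl
    ...   | inj₂ w∈S-t-s = ⊥-elim (S-t-s=∅ (w , w∈S-t-s))
    only-s root₁ t-R₁ = ⊥-elim (¬R₁ t∈S t-R₁)
    only-s root₂ t-R₂ = ⊥-elim (¬R₂ t∈S t-R₂)
  ...   | yes S-t-s≠∅ with rec S-t-s⊂S roots S-t-s≠∅
    where
    S-t-s⊂S : S - t - s ⊂ S
    S-t-s⊂S = ⊆-⊂-trans (p─q⊆p _ _) (x∈p⇒p-x⊂p t∈S)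
    roots : Roots (S - t - s) ⁅ t ⁆ ⁅ s ⁆
    roots = roots-⁅⁆ (λ t∈ → x∈p-y⇒x≢y (p─q⊆p _ _ t∈) refl) (disjoint-⁅⁆ (λ s∈ → x∈p-y⇒x≢y s∈ refl))
              (adj⇒≢ ts ∘ x∈⁅y⁆⇒x≡y s) connected-⁅⁆ (touches-⁅⁆ ts)
  ...     | v , v∈ , two = v , v∈S , atMostTwo-image (relabel (vertex t) (vertex s)) lift two
    where
    v∈S : v ∈ S
    v∈S = p─q⊆p _ _ (p─q⊆p _ _ v∈)
    lift : ∀ x → NeighbourIn S R₁ R₂ v x →
      ∃ λ y → NeighbourIn (S - t - s) ⁅ t ⁆ ⁅ s ⁆ v y × relabel (vertex t) (vertex s) y ≡ x
    lift (vertex w) (w∈S , vw) with x∈p⇒x≡y⊎x∈p-y t w∈S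
    ... | inj₁ w≡t = root-neighbour (vertex s) (inj₁ w≡t) vw
    ... | inj₂ w∈S-t with x∈p⇒x≡y⊎x∈p-y s w∈S-t
    ...   | inj₁ refl = root₂ , touches-⁅⁆ vw , refl
    ...   | inj₂ w∈S-t-s = root-neighbour (vertex s) (inj₂ w∈S-t-s) vw
    lift root₁ v-R₁ = ⊥-elim (¬R₁ v∈S v-R₁)
    lift root₂ v-R₂ = ⊥-elim (¬R₂ v∈S v-R₂)

  one-side-low : LowBelow S → Roots S R₁ R₂ → (∀ {v} → v ∈ S → Touches R₁ v → ¬ Touches R₂ v) →
    t ∈ S → Touches R₁ t ⊎ Touches R₂ t → HasLowVertex S R₁ R₂
  one-side-low {S} {R₁} {R₂} {t} rec roots not-both t∈S t-R with nonempty? (S - t)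
  ... | no S-t=∅ = t , t∈S , isolated-low (alone⇒isolated S-t=∅)
  ... | yes S-t≠∅ with rec (x∈p⇒p-x⊂p t∈S) roots′ S-t≠∅
    where
    open Roots roots
    roots′ : Roots (S - t) ⁅ t ⁆ (R₁ ∪ R₂)
    roots′ = roots-⁅⁆ (λ t∈ → x∈p-y⇒x≢y t∈ refl)
      (λ v∈S-t v∈R → [ S∩R₁=∅ (p─q⊆p _ _ v∈S-t) , S∩R₂=∅ (p─q⊆p _ _ v∈S-t) ]′ (x∈p∪q⁻ R₁ R₂ v∈R))
      (λ t∈R → [ S∩R₁=∅ t∈S , S∩R₂=∅ t∈S ]′ (x∈p∪q⁻ R₁ R₂ t∈R))
      (connected-∪ R₁-connected R₂-connected R₁-R₂-joined)
      ([ touches-⊆ (p⊆p∪q R₂) , touches-⊆ (q⊆p∪q R₁ R₂) ]′ t-R)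
  ... | v , v∈S-t , two = v , v∈S , atMostTwo-image (relabel (vertex t) (proj₁ side)) lift two
    where
    v∈S : v ∈ S
    v∈S = p─q⊆p _ _ v∈S-t
    side : ∃ λ r → (Touches R₁ v → r ≡ root₁) × (Touches R₂ v → r ≡ root₂)
    side with touches? R₁ v
    ... | yes v-R₁ = root₁ , (λ _ → refl) , λ v-R₂ → ⊥-elim (not-both v∈S v-R₁ v-R₂)
    ... | no ¬v-R₁ = root₂ , (λ v-R₁ → ⊥-elim (¬v-R₁ v-R₁)) , λ _ → refl
    lift : ∀ x → NeighbourIn S R₁ R₂ v x →
      ∃ λ y → NeighbourIn (S - t) ⁅ t ⁆ (R₁ ∪ R₂) v y × relabel (vertex t) (proj₁ side) y ≡ x
    lift (vertex w) (w∈S , vw) = root-neighbour _ (x∈p⇒x≡y⊎x∈p-y t w∈S) vw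
    lift root₁ v-R₁ = root₂ , touches-⊆ (p⊆p∪q R₂) v-R₁ , proj₁ (proj₂ side) v-R₁
    lift root₂ v-R₂ = root₂ , touches-⊆ (q⊆p∪q R₁ R₂) v-R₂ , proj₂ (proj₂ side) v-R₂

  module _ (K4-free : K4MinorFree G) where

    module BothSides {S R₁ R₂ t u} (rec : LowBelow S) (roots : Roots S R₁ R₂)
                     (t∈S : t ∈ S) (t-R₁ : Touches R₁ t) (t-R₂ : Touches R₂ t)
                     (C : Component (S - t) u) where
      open Roots roots
      open Component C renaming (K⊆S to K⊆S-t)

      K⊆S : K ⊆ S
      K⊆S = p─q⊆p _ _ ∘ K⊆S-t

      K⊂S : K ⊂ S
      K⊂S = ⊆-⊂-trans (K⊆S-t) (x∈p⇒p-x⊂p t∈S)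

      t∉K : t ∉ K
      t∉K t∈K = x∈p-y⇒x≢y (K⊆S-t t∈K) refl

      K-neighbour : v ∈ K → w ∈ S → Adj v w → w ≡ t ⊎ w ∈ K
      K-neighbour v∈K w∈S vw = map₂ (λ w∈S-t → closed v∈K w∈S-t vw) (x∈p⇒x≡y⊎x∈p-y _ w∈S)

      k4Model : Joined K R₁ → Joined K R₂ → Joined K ⁅ t ⁆ → K4Model
      k4Model K-R₁ K-R₂ K-t = record
        { branch    = R₁ ∷ R₂ ∷ ⁅ t ⁆ ∷ K ∷ []
        ; connected = R₁-connected ∷ R₂-connected ∷ connected-⁅⁆ ∷ connected ∷ []
        ; disjoint  = (R₁∩R₂=∅ ∷ disjoint-⁅⁆ (S∩R₁=∅ t∈S) ∷ disjoint-sym (disjoint-⊆ K⊆S S∩R₁=∅) ∷ [])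
                    ∷ (disjoint-⁅⁆ (S∩R₂=∅ t∈S) ∷ disjoint-sym (disjoint-⊆ K⊆S S∩R₂=∅) ∷ [])
                    ∷ (disjoint-sym (disjoint-⁅⁆ t∉K) ∷ []) ∷ [] ∷ []
        ; joined    = (R₁-R₂-joined ∷ joined-sym t-joins-R₁ ∷ joined-sym K-R₁ ∷ [])
                    ∷ (joined-sym t-joins-R₂ ∷ joined-sym K-R₂ ∷ [])
                    ∷ (joined-sym K-t ∷ []) ∷ [] ∷ []
        }
        where
        t-joins-R₁ : Joined ⁅ t ⁆ R₁
        t-joins-R₁ = t , x∈⁅x⁆ t , t-R₁
        t-joins-R₂ : Joined ⁅ t ⁆ R₂
        t-joins-R₂ = t , x∈⁅x⁆ t , t-R₂

      avoiding-R₂ : ¬ Joined K R₂ → HasLowVertex S R₁ R₂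
      avoiding-R₂ ¬K-R₂
        with rec K⊂S (roots-⁅⁆ t∉K (disjoint-⊆ K⊆S S∩R₁=∅) (S∩R₁=∅ t∈S) R₁-connected t-R₁) (u , u∈K)
      ... | v , v∈K , two = v , K⊆S v∈K , atMostTwo-image (relabel (vertex t) root₁) lift two
        where
        lift : ∀ x → NeighbourIn S R₁ R₂ v x →
          ∃ λ y → NeighbourIn K ⁅ t ⁆ R₁ v y × relabel (vertex t) root₁ y ≡ x
        lift (vertex w) (w∈S , vw) = root-neighbour _ (K-neighbour v∈K w∈S vw) vw
        lift root₁ v-R₁ = root₂ , v-R₁ , refl
        lift root₂ v-R₂ = ⊥-elim (¬K-R₂ (v , v∈K , v-R₂))

      avoiding-R₁ : ¬ Joined K R₁ → HasLowVertex S R₁ R₂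
      avoiding-R₁ ¬K-R₁
        with rec K⊂S (roots-⁅⁆ t∉K (disjoint-⊆ K⊆S S∩R₂=∅) (S∩R₂=∅ t∈S) R₂-connected t-R₂) (u , u∈K)
      ... | v , v∈K , two = v , K⊆S v∈K , atMostTwo-image (relabel (vertex t) root₂) lift two
        where
        lift : ∀ x → NeighbourIn S R₁ R₂ v x →
          ∃ λ y → NeighbourIn K ⁅ t ⁆ R₂ v y × relabel (vertex t) root₂ y ≡ x
        lift (vertex w) (w∈S , vw) = root-neighbour _ (K-neighbour v∈K w∈S vw) vw
        lift root₁ v-R₁ = ⊥-elim (¬K-R₁ (v , v∈K , v-R₁))
        lift root₂ v-R₂ = root₂ , v-R₂ , refl

      avoiding-t : ¬ Joined K ⁅ t ⁆ → HasLowVertex S R₁ R₂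
      avoiding-t ¬K-t with rec K⊂S (roots-⊆ K⊆S roots) (u , u∈K)
      ... | v , v∈K , two = v , K⊆S v∈K , atMostTwo-image id lift two
        where
        lift : ∀ x → NeighbourIn S R₁ R₂ v x → ∃ λ y → NeighbourIn K R₁ R₂ v y × y ≡ x
        lift (vertex w) (w∈S , vw) with K-neighbour v∈K w∈S vw
        ... | inj₁ refl = ⊥-elim (¬K-t (v , v∈K , touches-⁅⁆ vw))
        ... | inj₂ w∈K = vertex w , (w∈K , vw) , refl
        lift root₁ v-R₁ = root₁ , v-R₁ , refl
        lift root₂ v-R₂ = root₂ , v-R₂ , refl

      low : HasLowVertex S R₁ R₂
      low with joined? K R₁ | joined? K R₂ | joined? K ⁅ t ⁆
      ... | _        | no ¬K-R₂ | _       = avoiding-R₂ ¬K-R₂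
      ... | no ¬K-R₁ | yes _    | _       = avoiding-R₁ ¬K-R₁
      ... | yes _    | yes _    | no ¬K-t = avoiding-t ¬K-t
      ... | yes K-R₁ | yes K-R₂ | yes K-t = ⊥-elim (K4-free (k4Minor (k4Model K-R₁ K-R₂ K-t)))

    both-sides-low : LowBelow S → Roots S R₁ R₂ → t ∈ S → Touches R₁ t → Touches R₂ t →
      HasLowVertex S R₁ R₂
    both-sides-low {S} {t = t} rec roots t∈S t-R₁ t-R₂ with nonempty? (S - t)
    ... | no S-t=∅ = t , t∈S , isolated-low (alone⇒isolated S-t=∅)
    ... | yes (u , u∈S-t) = BothSides.low rec roots t∈S t-R₁ t-R₂ (component u∈S-t)

    low-vertex-step : LowBelow S → Roots S R₁ R₂ → Nonempty S → HasLowVertex S R₁ R₂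
    low-vertex-step {S} {R₁} {R₂} rec roots S≠∅
      with any? (λ t → t ∈? S ×-dec touches? R₁ t ×-dec touches? R₂ t)
    ... | yes (t , t∈S , t-R₁ , t-R₂) = both-sides-low rec roots t∈S t-R₁ t-R₂
    ... | no ¬both with any? (λ t → t ∈? S ×-dec (touches? R₁ t ⊎-dec touches? R₂ t))
    ...   | yes (t , t∈S , t-R) =
      one-side-low rec roots (λ v∈S v-R₁ v-R₂ → ¬both (_ , v∈S , v-R₁ , v-R₂)) t∈S t-R
    ...   | no ¬any = untouched-low rec (λ v∈S v-R₁ → ¬any (_ , v∈S , inj₁ v-R₁))
                                       (λ v∈S v-R₂ → ¬any (_ , v∈S , inj₂ v-R₂)) S≠∅

    low-vertex : Roots S R₁ R₂ → Nonempty S → HasLowVertex S R₁ R₂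
    low-vertex = go (⊂-wellFounded _)
      where
      go : Acc _⊂_ S → Roots S R₁ R₂ → Nonempty S → HasLowVertex S R₁ R₂
      go (acc smaller) = low-vertex-step (λ S′⊂S → go (smaller S′⊂S))

    two-degenerate : Nonempty S → ∃ λ v → v ∈ S × AtMostTwo (λ w → w ∈ S × Adj v w)
    two-degenerate S≠∅ with untouched-low {R₁ = ∅} {R₂ = ∅} (λ _ → low-vertex)
                              (λ _ (_ , w∈∅ , _) → ∉⊥ w∈∅) (λ _ (_ , w∈∅ , _) → ∉⊥ w∈∅) S≠∅
    ... | v , v∈S , two = v , v∈S , atMostTwo-image node-vertex (λ w nbr → vertex w , nbr , refl) two
      where
      node-vertex : Node → V G
      node-vertex (vertex w) = w
      node-vertex _          = v

    ProperOn : Subset n → (V G → Fin 3) → Set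
    ProperOn S col = ∀ {u w} → u ∈ S → w ∈ S → Adj u w → col u ≢ col w

    three-colourable-on : ∀ S → ∃ λ col → ProperOn S col
    three-colourable-on S = go S (⊂-wellFounded S)
      where
      go : ∀ S → Acc _⊂_ S → ∃ λ col → ProperOn S col
      go S (acc smaller) with nonempty? S
      ... | no S=∅ = (λ _ → zero) , λ u∈S _ _ _ → S=∅ (_ , u∈S)
      ... | yes S≠∅ with two-degenerate S≠∅
      ...   | v , v∈S , a , b , nbrs with go (S - v) (smaller (x∈p⇒p-x⊂p v∈S))
      ...     | col′ , proper′ = col , proper
        where
        fresh : ∃ λ c → c ≢ col′ a × c ≢ col′ b
        fresh = third-colour (col′ a) (col′ b)

        c : Fin 3
        c = proj₁ fresh

        col : V G → Fin 3
        col w with w ≟ v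
        ... | yes _ = c
        ... | no _  = col′ w

        c-fresh : w ∈ S → Adj v w → c ≢ col′ w
        c-fresh w∈S vw with nbrs _ (w∈S , vw)
        ... | inj₁ refl = proj₁ (proj₂ fresh)
        ... | inj₂ refl = proj₂ (proj₂ fresh)

        proper : ProperOn S col
        proper {u} {w} u∈S w∈S uw with u ≟ v | w ≟ v
        ... | yes refl | yes refl = ⊥-elim (irrefl uw)
        ... | yes refl | no _     = c-fresh w∈S uw
        ... | no _     | yes refl = ≢-sym (c-fresh u∈S (adj-sym uw))
        ... | no u≢v   | no w≢v   =
          proper′ (x∈p∧x≢y⇒x∈p-y u∈S u≢v) (x∈p∧x≢y⇒x∈p-y w∈S w≢v) uw

    three-colourable : ∃ λ col → Proper3Coloring G col
    three-colourable =
      let col , proper = three-colourable-on ⊤ in col , proper ∈⊤ ∈⊤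

  diamond-chain-monochromatic : ∀ {col m} → Proper3Coloring G col → (φ : DiamondChainHom G m) →
    ∀ i → col (DiamondChainHom.uu φ i) ≡ col (DiamondChainHom.uu φ zero)
  diamond-chain-monochromatic {col} proper φ = <-weakInduction _ refl step
    where
    open DiamondChainHom φ
    step : ∀ i → col (uu (inject₁ i)) ≡ col (uu zero) → col (uu (suc i)) ≡ col (uu zero)
    step i IH = trans
      (third-colour-unique _ _ _ _ (proper (e-vw i)) (≢-sym (proper (e-vu i))) (≢-sym (proper (e-wu i)))
                                   (proper (e-uv i)) (proper (e-uw i)))
      IH

  connected-by-diamonds⇒monochromatic : ∀ {col a b c} → Proper3Coloring G col →
    ConnByDiamonds G a b c → col a ≡ col b × col b ≡ col c
  connected-by-diamonds⇒monochromatic {col} proper (_ , φ , (i , refl) , (j , refl) , (k , refl)) =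
    trans (same i) (sym (same j)) , trans (same j) (sym (same k))
    where
    same : ∀ i → col (DiamondChainHom.uu φ i) ≡ col (DiamondChainHom.uu φ zero)
    same = diamond-chain-monochromatic proper φ

module _ {G : Graph} {col : V G → Fin 3} (proper : Proper3Coloring G col) {y z : V G} (y≢z : y ≢ z) where

  feasible : ∀ {a} → y ≢ a → z ≢ a → ¬ (col a ≡ col y × col y ≡ col z) →
    AtMostTwoColors G col a y z → Feasible G a y z
  feasible y≢a z≢a not-mono few =
    (≢-sym y≢a , ≢-sym z≢a , y≢z) , not-mono ∘ connected-by-diamonds⇒monochromatic G proper ,
    col , proper , few

  feasible-at-one-end : ∀ {x x'} → Graph.Adj G x x' → y ≢ x → y ≢ x' → z ≢ x → z ≢ x' →
    Feasible G x y z ⊎ Feasible G x' y z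
  feasible-at-one-end {x} {x'} xx' y≢x y≢x' z≢x z≢x' with col y ≟ col z
  ... | yes yz with col x ≟ col y
  ...   | no xy  = inj₁ (feasible y≢x z≢x (xy ∘ proj₁) (inj₂ (inj₂ yz)))
  ...   | yes xy = inj₂ (feasible y≢x' z≢x' (λ (x'y , _) → proper xx' (trans xy (sym x'y))) (inj₂ (inj₂ yz)))
  feasible-at-one-end {x} {x'} xx' y≢x y≢x' z≢x z≢x' | no ¬yz =
    [ inj₁ ∘ feasible y≢x z≢x (¬yz ∘ proj₂) ∘ map₂ inj₁
    , inj₂ ∘ feasible y≢x' z≢x' (¬yz ∘ proj₂) ∘ map₂ inj₁
    ]′ (distinct-pairs-meet _ _ _ _ ¬yz (proper xx'))

corollary3 : (G : Graph) → K4MinorFree G →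
    (x x' y z : V G) → Graph.Adj G x x' →
    y ≢ z → y ≢ x → y ≢ x' → z ≢ x → z ≢ x' →
    Feasible G x y z ⊎ Feasible G x' y z
corollary3 G K4-free x x' y z xx' y≢z =
  feasible-at-one-end (proj₂ (three-colourable G K4-free)) y≢z xx'
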